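{- The quadratic form $(u,v,w)\mapsto u^2-vw$ on $\mathfrak{L}_T$ is positive definite of rank $2$ and has discriminant $D$. In particular $r_T(A)<\infty$.
   Context: Let $T$ be a positive definite rational symmetric $2\times 2$ matrix written as $T=\frac{1}{M}(\begin{smallmatrix} n & r/2 \\ r/2 & m\end{smallmatrix})$ with $M$ a positive integer and $n,r,m$ coprime integers, and let $D=r^2-4nm$. Let $\mathfrak{L}_T=\{(u,v,w)\in\mathbb{Z}^3 : ru+mv+nw=0\}$, and for a positive integer $A$ let $r_T(A)=\#\{(u,v,w)\in\mathfrak{L}_T : u^2-vw=A\}$. -}

module Defs where

open import Data.Integer using (ℤ; _+_; _-_; _*_; _<_; +_; 0ℤ; 1ℤ)
open import Data.Integer.GCD using (gcd)
open import Data.Product using (_×_; _,_; Σ)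
open import Relation.Binary.PropositionalEquality using (_≡_)
open import Relation.Nullary using (¬_)

ℤ³ : Set
ℤ³ = ℤ × ℤ × ℤ

zero³ : ℤ³
zero³ = 0ℤ , 0ℤ , 0ℤ

_⊕_ : ℤ³ → ℤ³ → ℤ³
(u , v , w) ⊕ (u' , v' , w') = (u + u') , (v + v') , (w + w')

_·_ : ℤ → ℤ³ → ℤ³
a · (u , v , w) = (a * u) , (a * v) , (a * w)

-- The matrix T = (1/M) [[n , r/2] , [r/2 , m]] is positive definite:
-- x^t T x = (n x² + r x y + m y²)/M > 0 for every nonzero (x , y)
-- (tested on integer vectors; rational vectors reduce to these by clearing denominators).
PosDefT : (M n r m : ℤ) → Set
PosDefT M n r m = ∀ (x y : ℤ) → ¬ ((x , y) ≡ (0ℤ , 0ℤ)) →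
  0ℤ < M * (n * x * x + r * x * y + m * y * y)

Coprime3 : (n r m : ℤ) → Set
Coprime3 n r m = gcd (gcd n r) m ≡ 1ℤ

disc : (n r m : ℤ) → ℤ
disc n r m = r * r - + 4 * n * m

InL : (n r m : ℤ) → ℤ³ → Set
InL n r m (u , v , w) = r * u + m * v + n * w ≡ 0ℤ

Q : ℤ³ → ℤ
Q (u , v , w) = u * u - v * w

-- its polar bilinear form B(x,y) = Q(x+y) - Q(x) - Q(y), so Q(a e₁ + b e₂) = Q e₁ a² + B e₁ e₂ a b + Q e₂ b²
B : ℤ³ → ℤ³ → ℤ
B x y = Q (x ⊕ y) - Q x - Q y

record IsBasis (n r m : ℤ) (e₁ e₂ : ℤ³) : Set where
  field
    e₁∈L : InL n r m e₁
    e₂∈L : InL n r m e₂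
    spans : ∀ x → InL n r m x → Σ ℤ λ a → Σ ℤ λ b → x ≡ (a · e₁) ⊕ (b · e₂)
    indep : ∀ a b → (a · e₁) ⊕ (b · e₂) ≡ zero³ → (a ≡ 0ℤ) × (b ≡ 0ℤ)

discBasis : ℤ³ → ℤ³ → ℤ
discBasis e₁ e₂ = B e₁ e₂ * B e₁ e₂ - + 4 * Q e₁ * Q e₂

-- On the lattice, n·Q(u, v, w) = n u² + r u v + m v² (eliminate n w = − r u − m v), so Q inherits
-- positive definiteness from T.  For a basis write g = gcd(n, m), n = n′ g, m = m′ g, s n′ + t m′ = 1.
-- Since gcd(g, r) = 1, the defining equation forces g ∣ u; subtracting (u / g)·(g, − r t, − r s)
-- leaves a vector (0, v′, w′) with m′ v′ + n′ w′ = 0, i.e. a multiple of (0, n′, − m′).  On this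
-- basis Q has discriminant r² (s n′ + t m′)² − 4 n m = D.  Finally, completing the square,
-- 4 n (n u² + r u v + m v²) = (4 n m − r²) v² + (2 n u + r v)², so each coordinate of a vector with
-- Q = A is bounded in terms of A and the representations of A lie in a finite box.

module Submission where

open import Defs
open import Data.Integer using (ℤ; _<_; 0ℤ)
open import Data.Product using (_×_; Σ; Σ-syntax)
open import Data.List using (List)
open import Data.List.Membership.Propositional using (_∈_)
open import Relation.Binary.PropositionalEquality using (_≡_)
open import Relation.Nullary using (¬_)
open import Function.Bundles using (_⇔_)

open import Data.Integer.Base
  using (+_; -[1+_]; 1ℤ; -_; _+_; _-_; _*_; _≤_; ∣_∣; +≤+; nonNegative; ≢-nonZero)
open import Data.Integer.Properties
open import Data.Integer.Tactic.RingSolver using (solve)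
open import Data.Integer.GCD using (gcd; gcd[i,j]∣i; gcd[i,j]∣j; gcd[i,j]≡0⇒i≡0)
open import Data.Integer.Divisibility.Signed using (divides; ∣ᵤ⇒∣; m∣∣m∣)
import Data.Nat.Base as ℕ
import Data.Nat.Properties as ℕ
import Data.Nat.GCD as ℕ
open import Data.Nat.GCD using (module Bézout)
open import Data.Product using (_,_; proj₁; proj₂; ∃; ∃₂)
open import Data.Product.Properties using (≡-dec)
open import Data.Sum using (inj₁; inj₂; fromInj₁)
open import Data.List using ([]; _∷_; filter; cartesianProduct)
open import Data.List.Membership.Propositional.Properties
  using (∈-filter⁻; ∈-filter⁺; ∈-cartesianProduct⁺)
open import Data.List.Relation.Unary.Any using (here; there)
open import Function.Base using (_∘_)
open import Function.Bundles using (mk⇔)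
open import Level using (0ℓ)
open import Relation.Binary.PropositionalEquality
  using (refl; sym; trans; cong; cong₂; subst; _≢_; ≢-sym; module ≡-Reasoning)
open import Relation.Nullary using (yes; no; contradiction)
open import Relation.Nullary.Decidable using (_×-dec_)
open import Relation.Unary using (Pred; Decidable)
open ≡-Reasoning

-- Integer arithmetic and Bézout identities

i*j≡0⇒i≡0 : ∀ {i j} → j ≢ 0ℤ → i * j ≡ 0ℤ → i ≡ 0ℤ
i*j≡0⇒i≡0 {i} j≢0 ij≡0 = fromInj₁ (λ j≡0 → contradiction j≡0 j≢0) (i*j≡0⇒i≡0∨j≡0 i ij≡0)

i-j*0≡i : ∀ i j → i - j * 0ℤ ≡ i
i-j*0≡i i j = trans (cong (_-_ i) (*-zeroʳ j)) (+-identityʳ i)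

0<i*j⇒0<j : ∀ {i j} → 0ℤ < i → 0ℤ < i * j → 0ℤ < j
0<i*j⇒0<j {i} 0<i 0<ij =
  *-cancelˡ-<-nonNeg i ⦃ nonNegative (<⇒≤ 0<i) ⦄ (subst (_< i * _) (sym (*-zeroʳ i)) 0<ij)

0≤i*i : ∀ i → 0ℤ ≤ i * i
0≤i*i (+ k)    = subst (0ℤ ≤_) (pos-* k k) (+≤+ ℕ.z≤n)
0≤i*i -[1+ k ] = +≤+ ℕ.z≤n

∣i∣≤∣i*i∣ : ∀ i → ∣ i ∣ ℕ.≤ ∣ i * i ∣
∣i∣≤∣i*i∣ i = subst (∣ i ∣ ℕ.≤_) (sym (abs-* i i)) (n≤n*n ∣ i ∣)
  where
  n≤n*n : ∀ n → n ℕ.≤ n ℕ.* n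
  n≤n*n ℕ.zero      = ℕ.z≤n
  n≤n*n n@(ℕ.suc _) = ℕ.m≤m*n n n

0≤i≤j⇒∣i∣≤∣j∣ : ∀ {i j} → 0ℤ ≤ i → i ≤ j → ∣ i ∣ ℕ.≤ ∣ j ∣
0≤i≤j⇒∣i∣≤∣j∣ (+≤+ _) (+≤+ i≤j) = i≤j

∣i∣≤∣k*i²+j²∣ : ∀ {k} i j → 0ℤ < k → ∣ i ∣ ℕ.≤ ∣ k * (i * i) + j * j ∣
∣i∣≤∣k*i²+j²∣ {k} i j 0<k = ℕ.≤-trans (∣i∣≤∣i*i∣ i) (0≤i≤j⇒∣i∣≤∣j∣ (0≤i*i i) i²≤k*i²+j²)
  where
  i²≤k*i² : i * i ≤ k * (i * i)
  i²≤k*i² = subst (_≤ k * (i * i)) (*-identityˡ (i * i))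
    (*-monoʳ-≤-nonNeg (i * i) ⦃ nonNegative (0≤i*i i) ⦄ (i<j⇒suc[i]≤j 0<k))
  i²≤k*i²+j² : i * i ≤ k * (i * i) + j * j
  i²≤k*i²+j² = ≤-trans i²≤k*i² (i≤i+j _ (j * j) ⦃ nonNegative (0≤i*i j) ⦄)

ℕ-identity⇒ℤ : ∀ d y b x a → d ℕ.+ y ℕ.* b ≡ x ℕ.* a → + x * + a + - + y * + b ≡ + d
ℕ-identity⇒ℤ d y b x a eq = begin
  + x * + a + - + y * + b         ≡⟨ cong (_+ - + y * + b) (sym (pos-* x a)) ⟩
  + (x ℕ.* a) + - + y * + b       ≡⟨ cong (λ k → + k + - + y * + b) (sym eq) ⟩
  + (d ℕ.+ y ℕ.* b) + - + y * + b ≡⟨ cong (_+ - + y * + b) (trans (pos-+ d _) (cong (_+_ (+ d)) (pos-* y b))) ⟩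
  + d + + y * + b + - + y * + b   ≡⟨ cancel (+ d) (+ y) (+ b) ⟩
  + d                             ∎
  where
  cancel : ∀ d y b → d + y * b + - y * b ≡ d
  cancel d y b = solve (d ∷ y ∷ b ∷ [])

ℕ-bézout⇒ℤ-bézout : ∀ {d a b} → Bézout.Identity d a b → ∃₂ λ s t → s * + a + t * + b ≡ + d
ℕ-bézout⇒ℤ-bézout {d} {a} {b} (Bézout.+- x y eq) = + x , - + y , ℕ-identity⇒ℤ d y b x a eq
ℕ-bézout⇒ℤ-bézout {d} {a} {b} (Bézout.-+ x y eq) =
  - + x , + y , trans (+-comm (- + x * + a) (+ y * + b)) (ℕ-identity⇒ℤ d x a y b eq)

bézout : ∀ i j → ∃₂ λ s t → s * i + t * j ≡ gcd i j
bézout i j with ℕ-bézout⇒ℤ-bézout (Bézout.identity (ℕ.gcd-GCD ∣ i ∣ ∣ j ∣)) | m∣∣m∣ {i} | m∣∣m∣ {j}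
... | s , t , eq | divides σ ∣i∣≡σi | divides τ ∣j∣≡τj = s * σ , t * τ , (begin
  s * σ * i + t * τ * j     ≡⟨ cong₂ _+_ (*-assoc s σ i) (*-assoc t τ j) ⟩
  s * (σ * i) + t * (τ * j) ≡⟨ cong₂ (λ p q → s * p + t * q) (sym ∣i∣≡σi) (sym ∣j∣≡τj) ⟩
  s * + ∣ i ∣ + t * + ∣ j ∣ ≡⟨ eq ⟩
  gcd i j                   ∎)

Bézout₃ : ℤ → ℤ → ℤ → Set
Bézout₃ n r m = ∃ λ α → ∃₂ λ β γ → α * n + β * r + γ * m ≡ 1ℤ

coprime₃⇒bézout₃ : ∀ {n r m} → Coprime3 n r m → Bézout₃ n r m
coprime₃⇒bézout₃ {n} {r} {m} coprime with bézout n r | bézout (gcd n r) m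
... | s₁ , t₁ , eq₁ | s₂ , t₂ , eq₂ = s₂ * s₁ , s₂ * t₁ , t₂ , (begin
  s₂ * s₁ * n + s₂ * t₁ * r + t₂ * m ≡⟨ solve (s₁ ∷ t₁ ∷ s₂ ∷ t₂ ∷ n ∷ r ∷ m ∷ []) ⟩
  s₂ * (s₁ * n + t₁ * r) + t₂ * m    ≡⟨ cong (λ h → s₂ * h + t₂ * m) eq₁ ⟩
  s₂ * gcd n r + t₂ * m              ≡⟨ eq₂ ⟩
  gcd (gcd n r) m                    ≡⟨ coprime ⟩
  1ℤ                                 ∎)

CoprimeCofactors : ℤ → ℤ → Set
CoprimeCofactors n m = ∃ λ g → ∃₂ λ n′ m′ → ∃₂ λ s t → n ≡ n′ * g × m ≡ m′ * g × s * n′ + t * m′ ≡ 1ℤ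

coprime-cofactors : ∀ n m → n ≢ 0ℤ → CoprimeCofactors n m
coprime-cofactors n m n≢0 with ∣ᵤ⇒∣ (gcd[i,j]∣i n m) | ∣ᵤ⇒∣ (gcd[i,j]∣j n m) | bézout n m
... | divides n′ n≡n′g | divides m′ m≡m′g | s , t , eq =
  g , n′ , m′ , s , t , n≡n′g , m≡m′g , *-cancelʳ-≡ _ _ g ⦃ ≢-nonZero g≢0 ⦄ (begin
    (s * n′ + t * m′) * g       ≡⟨ *-distribʳ-+ g (s * n′) (t * m′) ⟩
    s * n′ * g + t * m′ * g     ≡⟨ cong₂ _+_ (*-assoc s n′ g) (*-assoc t m′ g) ⟩
    s * (n′ * g) + t * (m′ * g) ≡⟨ cong₂ (λ p q → s * p + t * q) (sym n≡n′g) (sym m≡m′g) ⟩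
    s * n + t * m               ≡⟨ eq ⟩
    g                           ≡⟨ sym (*-identityˡ g) ⟩
    1ℤ * g                      ∎)
  where
  g = gcd n m
  g≢0 : g ≢ 0ℤ
  g≢0 = n≢0 ∘ gcd[i,j]≡0⇒i≡0 n m

-- Binary quadratic forms

form : ℤ → ℤ → ℤ → ℤ → ℤ → ℤ
form a b c x y = a * x * x + b * x * y + c * y * y

record PositiveDefinite (a b c : ℤ) : Set where
  constructor positiveDefinite
  field positive : ∀ x y → ¬ ((x , y) ≡ (0ℤ , 0ℤ)) → 0ℤ < form a b c x y
open PositiveDefinite

PosDefT⇒PositiveDefinite : ∀ {M a b c} → 0ℤ < M → PosDefT M a b c → PositiveDefinite a b c
PosDefT⇒PositiveDefinite 0<M posDefT = positiveDefinite λ x y xy≢0 → 0<i*j⇒0<j 0<M (posDefT x y xy≢0)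

posDef⇒0<a : ∀ {a b c} → PositiveDefinite a b c → 0ℤ < a
posDef⇒0<a {a} {b} {c} posDef = subst (0ℤ <_) form[1,0]≡a (positive posDef 1ℤ 0ℤ λ ())
  where
  form[1,0]≡a : a * 1ℤ * 1ℤ + b * 1ℤ * 0ℤ + c * 0ℤ * 0ℤ ≡ a
  form[1,0]≡a = solve (a ∷ b ∷ c ∷ [])

posDef⇒0<-disc : ∀ {a b c} → PositiveDefinite a b c → 0ℤ < - disc a b c
posDef⇒0<-disc {a} {b} {c} posDef =
  0<i*j⇒0<j 0<a (subst (0ℤ <_) form[b,-2a]≡-a*disc (positive posDef b (- (+ 2 * a)) [b,-2a]≢0))
  where
  0<a : 0ℤ < a
  0<a = posDef⇒0<a posDef
  [b,-2a]≢0 : ¬ ((b , - (+ 2 * a)) ≡ (0ℤ , 0ℤ))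
  [b,-2a]≢0 eq = >-irrefl (i*j≡0⇒i≡0 (λ ()) (trans (*-comm a (+ 2)) (neg-injective (cong proj₂ eq)))) 0<a
  form[b,-2a]≡-a*disc :
    a * b * b + b * b * - (+ 2 * a) + c * - (+ 2 * a) * - (+ 2 * a) ≡ a * - (b * b - + 4 * a * c)
  form[b,-2a]≡-a*disc = solve (a ∷ b ∷ c ∷ [])

form-swap : ∀ a b c x y → form a b c x y ≡ form c b a y x
form-swap a b c x y = begin
  a * x * x + b * x * y + c * y * y ≡⟨ solve (a ∷ b ∷ c ∷ x ∷ y ∷ []) ⟩
  c * y * y + b * y * x + a * x * x ∎

disc-swap : ∀ a b c → disc a b c ≡ disc c b a
disc-swap a b c = begin
  b * b - + 4 * a * c ≡⟨ solve (a ∷ b ∷ c ∷ []) ⟩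
  b * b - + 4 * c * a ∎

four-a*form : ∀ a b c x y →
  + 4 * a * form a b c x y ≡ - disc a b c * (y * y) + (+ 2 * a * x + b * y) * (+ 2 * a * x + b * y)
four-a*form a b c x y = begin
  + 4 * a * (a * x * x + b * x * y + c * y * y)                                  ≡⟨ solve (a ∷ b ∷ c ∷ x ∷ y ∷ []) ⟩
  - (b * b - + 4 * a * c) * (y * y) + (+ 2 * a * x + b * y) * (+ 2 * a * x + b * y) ∎

∣y∣≤∣4a*form∣ : ∀ a b c x y → 0ℤ < - disc a b c → ∣ y ∣ ℕ.≤ ∣ + 4 * a * form a b c x y ∣
∣y∣≤∣4a*form∣ a b c x y 0<-disc = subst (λ z → ∣ y ∣ ℕ.≤ ∣ z ∣) (sym (four-a*form a b c x y))
  (∣i∣≤∣k*i²+j²∣ y (+ 2 * a * x + b * y) 0<-disc)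

-- The lattice and its basis

n*Q≡form : ∀ n r m u v w → InL n r m (u , v , w) → n * Q (u , v , w) ≡ form n r m u v
n*Q≡form n r m u v w x∈L = begin
  n * (u * u - v * w)                                             ≡⟨ solve (n ∷ r ∷ m ∷ u ∷ v ∷ w ∷ []) ⟩
  n * u * u + r * u * v + m * v * v - v * (r * u + m * v + n * w) ≡⟨ cong (λ ℓ → form n r m u v - v * ℓ) x∈L ⟩
  form n r m u v - v * 0ℤ                                         ≡⟨ i-j*0≡i (form n r m u v) v ⟩
  form n r m u v                                                  ∎

m*Q≡form : ∀ n r m u v w → InL n r m (u , v , w) → m * Q (u , v , w) ≡ form m r n u w
m*Q≡form n r m u v w x∈L = begin
  m * (u * u - v * w)                                             ≡⟨ solve (n ∷ r ∷ m ∷ u ∷ v ∷ w ∷ []) ⟩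
  m * u * u + r * u * w + n * w * w - w * (r * u + m * v + n * w) ≡⟨ cong (λ ℓ → form m r n u w - w * ℓ) x∈L ⟩
  form m r n u w - w * 0ℤ                                         ≡⟨ i-j*0≡i (form m r n u w) w ⟩
  form m r n u w                                                  ∎

Q-positive : ∀ {n r m} → PositiveDefinite n r m → ∀ x → InL n r m x → ¬ (x ≡ zero³) → 0ℤ < Q x
Q-positive {n} {r} {m} posDef (u , v , w) x∈L x≢0 with ≡-dec _≟_ _≟_ (u , v) (0ℤ , 0ℤ)
... | no uv≢0 =
  0<i*j⇒0<j (posDef⇒0<a posDef) (subst (0ℤ <_) (sym (n*Q≡form n r m u v w x∈L)) (positive posDef u v uv≢0))
... | yes refl = contradiction (cong (λ w → 0ℤ , 0ℤ , w) w≡0) x≢0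
  where
  w≡0 : w ≡ 0ℤ
  w≡0 = i*j≡0⇒i≡0 (≢-sym (<⇒≢ (posDef⇒0<a posDef))) (begin
    w * n                        ≡⟨ solve (r ∷ m ∷ n ∷ w ∷ []) ⟩
    r * 0ℤ + m * 0ℤ + n * w      ≡⟨ x∈L ⟩
    0ℤ                           ∎)

B-polar : ∀ u v w u′ v′ w′ → B (u , v , w) (u′ , v′ , w′) ≡ + 2 * u * u′ - v * w′ - w * v′
B-polar u v w u′ v′ w′ = begin
  (u + u′) * (u + u′) - (v + v′) * (w + w′) - (u * u - v * w) - (u′ * u′ - v′ * w′)
    ≡⟨ solve (u ∷ v ∷ w ∷ u′ ∷ v′ ∷ w′ ∷ []) ⟩
  + 2 * u * u′ - v * w′ - w * v′ ∎

module LatticeBasis (r g n′ m′ s t : ℤ) (n≢0 : n′ * g ≢ 0ℤ) (cofactors : s * n′ + t * m′ ≡ 1ℤ) where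

  e₁ e₂ : ℤ³
  e₁ = 0ℤ , n′ , - m′
  e₂ = g , - (r * t) , - (r * s)

  g≢0 : g ≢ 0ℤ
  g≢0 g≡0 = n≢0 (trans (cong (n′ *_) g≡0) (*-zeroʳ n′))

  n′≢0 : n′ ≢ 0ℤ
  n′≢0 n′≡0 = n≢0 (cong (_* g) n′≡0)

  e₁∈L : InL (n′ * g) r (m′ * g) e₁
  e₁∈L = begin
    r * 0ℤ + m′ * g * n′ + n′ * g * - m′ ≡⟨ solve (r ∷ g ∷ n′ ∷ m′ ∷ []) ⟩
    0ℤ                                  ∎

  e₂∈L : InL (n′ * g) r (m′ * g) e₂
  e₂∈L = begin
    r * g + m′ * g * - (r * t) + n′ * g * - (r * s) ≡⟨ solve (r ∷ g ∷ n′ ∷ m′ ∷ s ∷ t ∷ []) ⟩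
    r * g * (1ℤ - (s * n′ + t * m′))                ≡⟨ cong (λ c → r * g * (1ℤ - c)) cofactors ⟩
    r * g * (1ℤ - 1ℤ)                               ≡⟨ solve (r ∷ g ∷ []) ⟩
    0ℤ                                              ∎

  independent : ∀ a b → (a · e₁) ⊕ (b · e₂) ≡ zero³ → a ≡ 0ℤ × b ≡ 0ℤ
  independent a b eq = a≡0 , b≡0
    where
    b≡0 : b ≡ 0ℤ
    b≡0 = i*j≡0⇒i≡0 g≢0 (begin
      b * g          ≡⟨ solve (a ∷ b ∷ g ∷ []) ⟩
      a * 0ℤ + b * g ≡⟨ cong proj₁ eq ⟩
      0ℤ             ∎)
    a≡0 : a ≡ 0ℤ
    a≡0 = i*j≡0⇒i≡0 n′≢0 (begin
      a * n′                   ≡⟨ sym (+-identityʳ (a * n′)) ⟩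
      a * n′ + 0ℤ * - (r * t)  ≡⟨ cong (λ b → a * n′ + b * - (r * t)) (sym b≡0) ⟩
      a * n′ + b * - (r * t)   ≡⟨ cong (proj₁ ∘ proj₂) eq ⟩
      0ℤ                       ∎)

  first-coordinate-divisible : Bézout₃ (n′ * g) r (m′ * g) →
    ∀ {u v w} → InL (n′ * g) r (m′ * g) (u , v , w) → ∃ λ k → u ≡ k * g
  -- k = u / g, computed from u = u (α n + β r + γ m) and r u = − (m v + n w).
  first-coordinate-divisible (α , β , γ , αn+βr+γm≡1) {u} {v} {w} x∈L =
    α * n′ * u + γ * m′ * u - β * (m′ * v + n′ * w) , sym (begin
      (α * n′ * u + γ * m′ * u - β * (m′ * v + n′ * w)) * g
        ≡⟨ solve (α ∷ β ∷ γ ∷ r ∷ g ∷ n′ ∷ m′ ∷ u ∷ v ∷ w ∷ []) ⟩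
      u * (α * (n′ * g) + β * r + γ * (m′ * g)) - β * (r * u + m′ * g * v + n′ * g * w)
        ≡⟨ cong₂ (λ c ℓ → u * c - β * ℓ) αn+βr+γm≡1 x∈L ⟩
      u * 1ℤ - β * 0ℤ
        ≡⟨ solve (u ∷ β ∷ []) ⟩
      u ∎)

  kernel-multiple : ∀ a b → m′ * a + n′ * b ≡ 0ℤ → ∃ λ j → a ≡ j * n′ × b ≡ j * - m′
  kernel-multiple a b kernel = s * a - t * b , sym (begin
      (s * a - t * b) * n′                          ≡⟨ solve (n′ ∷ m′ ∷ s ∷ t ∷ a ∷ b ∷ []) ⟩
      (s * n′ + t * m′) * a - t * (m′ * a + n′ * b) ≡⟨ cong₂ (λ c z → c * a - t * z) cofactors kernel ⟩
      1ℤ * a - t * 0ℤ                               ≡⟨ solve (a ∷ t ∷ []) ⟩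
      a                                             ∎) , sym (begin
      (s * a - t * b) * - m′                        ≡⟨ solve (n′ ∷ m′ ∷ s ∷ t ∷ a ∷ b ∷ []) ⟩
      (s * n′ + t * m′) * b - s * (m′ * a + n′ * b) ≡⟨ cong₂ (λ c z → c * b - s * z) cofactors kernel ⟩
      1ℤ * b - s * 0ℤ                               ≡⟨ solve (b ∷ s ∷ []) ⟩
      b                                             ∎)

  reduced-equation : ∀ k v w → InL (n′ * g) r (m′ * g) (k * g , v , w) → r * k + m′ * v + n′ * w ≡ 0ℤ
  reduced-equation k v w x∈L = i*j≡0⇒i≡0 g≢0 (begin
    (r * k + m′ * v + n′ * w) * g         ≡⟨ solve (r ∷ g ∷ n′ ∷ m′ ∷ k ∷ v ∷ w ∷ []) ⟩
    r * (k * g) + m′ * g * v + n′ * g * w ≡⟨ x∈L ⟩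
    0ℤ                                    ∎)

  shifted-kernel : ∀ k v w → r * k + m′ * v + n′ * w ≡ 0ℤ → m′ * (v + r * t * k) + n′ * (w + r * s * k) ≡ 0ℤ
  shifted-kernel k v w reduced = begin
    m′ * (v + r * t * k) + n′ * (w + r * s * k)              ≡⟨ solve (r ∷ n′ ∷ m′ ∷ s ∷ t ∷ k ∷ v ∷ w ∷ []) ⟩
    r * k + m′ * v + n′ * w + r * k * (s * n′ + t * m′ - 1ℤ) ≡⟨ cong₂ (λ z c → z + r * k * (c - 1ℤ)) reduced cofactors ⟩
    0ℤ + r * k * (1ℤ - 1ℤ)                                   ≡⟨ solve (r ∷ k ∷ []) ⟩
    0ℤ                                                       ∎

  quotient-coordinates : ∀ k v w → r * k + m′ * v + n′ * w ≡ 0ℤ →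
    ∃₂ λ a b → (k * g , v , w) ≡ (a · e₁) ⊕ (b · e₂)
  quotient-coordinates k v w reduced =
    from-kernel (kernel-multiple (v + r * t * k) (w + r * s * k) (shifted-kernel k v w reduced))
    where
    from-kernel : (∃ λ j → v + r * t * k ≡ j * n′ × w + r * s * k ≡ j * - m′) →
      ∃₂ λ a b → (k * g , v , w) ≡ (a · e₁) ⊕ (b · e₂)
    from-kernel (j , v+rtk≡jn′ , w+rsk≡-jm′) = j , k , cong₂ _,_ u≡ (cong₂ _,_ v≡ w≡)
      where
      u≡ : k * g ≡ j * 0ℤ + k * g
      u≡ = solve (j ∷ k ∷ g ∷ [])
      v≡ : v ≡ j * n′ + k * - (r * t)
      v≡ = begin
        v                             ≡⟨ solve (r ∷ t ∷ k ∷ v ∷ []) ⟩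
        v + r * t * k + k * - (r * t) ≡⟨ cong (_+ k * - (r * t)) v+rtk≡jn′ ⟩
        j * n′ + k * - (r * t)        ∎
      w≡ : w ≡ j * - m′ + k * - (r * s)
      w≡ = begin
        w                             ≡⟨ solve (r ∷ s ∷ k ∷ w ∷ []) ⟩
        w + r * s * k + k * - (r * s) ≡⟨ cong (_+ k * - (r * s)) w+rsk≡-jm′ ⟩
        j * - m′ + k * - (r * s)      ∎

  spans : Bézout₃ (n′ * g) r (m′ * g) → ∀ x → InL (n′ * g) r (m′ * g) x → ∃₂ λ a b → x ≡ (a · e₁) ⊕ (b · e₂)
  spans bézout₃ (u , v , w) x∈L = from-quotient (first-coordinate-divisible bézout₃ x∈L) x∈L
    where
    from-quotient : ∀ {u} → ∃ (λ k → u ≡ k * g) → InL (n′ * g) r (m′ * g) (u , v , w) →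
      ∃₂ λ a b → (u , v , w) ≡ (a · e₁) ⊕ (b · e₂)
    from-quotient (k , refl) x∈L = quotient-coordinates k v w (reduced-equation k v w x∈L)

  isBasis : Bézout₃ (n′ * g) r (m′ * g) → IsBasis (n′ * g) r (m′ * g) e₁ e₂
  isBasis bézout₃ = record { e₁∈L = e₁∈L ; e₂∈L = e₂∈L ; spans = spans bézout₃ ; indep = independent }

  discBasis≡disc : discBasis e₁ e₂ ≡ disc (n′ * g) r (m′ * g)
  discBasis≡disc = begin
    B e₁ e₂ * B e₁ e₂ - + 4 * Q e₁ * Q e₂
      ≡⟨ cong (λ b → b * b - + 4 * Q e₁ * Q e₂) (B-polar 0ℤ n′ (- m′) g (- (r * t)) (- (r * s))) ⟩
    (+ 2 * 0ℤ * g - n′ * - (r * s) - - m′ * - (r * t)) * (+ 2 * 0ℤ * g - n′ * - (r * s) - - m′ * - (r * t))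
      - + 4 * (0ℤ * 0ℤ - n′ * - m′) * (g * g - - (r * t) * - (r * s))
      ≡⟨ solve (r ∷ g ∷ n′ ∷ m′ ∷ s ∷ t ∷ []) ⟩
    r * r * ((s * n′ + t * m′) * (s * n′ + t * m′)) - + 4 * (n′ * g) * (m′ * g)
      ≡⟨ cong (λ c → r * r * (c * c) - + 4 * (n′ * g) * (m′ * g)) cofactors ⟩
    r * r * (1ℤ * 1ℤ) - + 4 * (n′ * g) * (m′ * g)
      ≡⟨ solve (r ∷ g ∷ n′ ∷ m′ ∷ []) ⟩
    r * r - + 4 * (n′ * g) * (m′ * g) ∎

lattice-basis : ∀ n r m → Coprime3 n r m → n ≢ 0ℤ →
  Σ[ e₁ ∈ ℤ³ ] Σ[ e₂ ∈ ℤ³ ] (IsBasis n r m e₁ e₂ × discBasis e₁ e₂ ≡ disc n r m)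
lattice-basis n r m coprime n≢0 =
  from-cofactors (coprime-cofactors n m n≢0) (coprime₃⇒bézout₃ coprime) n≢0
  where
  from-cofactors : ∀ {n m} → CoprimeCofactors n m → Bézout₃ n r m → n ≢ 0ℤ →
    Σ[ e₁ ∈ ℤ³ ] Σ[ e₂ ∈ ℤ³ ] (IsBasis n r m e₁ e₂ × discBasis e₁ e₂ ≡ disc n r m)
  from-cofactors (g , n′ , m′ , s , t , refl , refl , cofactors) bézout₃ n≢0 =
    e₁ , e₂ , isBasis bézout₃ , discBasis≡disc
    where open LatticeBasis r g n′ m′ s t n≢0 cofactors

-- Finiteness of representations

interval : ℕ.ℕ → List ℤ
interval ℕ.zero    = 0ℤ ∷ []
interval (ℕ.suc k) = + ℕ.suc k ∷ -[1+ k ] ∷ interval k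

∣i∣≤k⇒i∈interval : ∀ {k i} → ∣ i ∣ ℕ.≤ k → i ∈ interval k
∣i∣≤k⇒i∈interval {ℕ.zero}  {+ ℕ.zero} _ = here refl
∣i∣≤k⇒i∈interval {ℕ.suc k} {+ _} ∣i∣≤1+k with ℕ.m≤n⇒m<n∨m≡n ∣i∣≤1+k
... | inj₁ (ℕ.s≤s ∣i∣≤k) = there (there (∣i∣≤k⇒i∈interval ∣i∣≤k))
... | inj₂ refl          = here refl
∣i∣≤k⇒i∈interval {ℕ.suc k} { -[1+ _ ]} ∣i∣≤1+k with ℕ.m≤n⇒m<n∨m≡n ∣i∣≤1+k
... | inj₁ (ℕ.s≤s ∣i∣≤k) = there (there (∣i∣≤k⇒i∈interval ∣i∣≤k))
... | inj₂ refl          = there (here refl)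

box : ℕ.ℕ → ℕ.ℕ → ℕ.ℕ → List ℤ³
box a b c = cartesianProduct (interval a) (cartesianProduct (interval b) (interval c))

bounded⇒listable : ∀ {P : Pred ℤ³ 0ℓ} → Decidable P → ∀ a b c →
  (∀ {u v w} → P (u , v , w) → ∣ u ∣ ℕ.≤ a × ∣ v ∣ ℕ.≤ b × ∣ w ∣ ℕ.≤ c) →
  Σ[ xs ∈ List ℤ³ ] (∀ x → x ∈ xs ⇔ P x)
bounded⇒listable P? a b c bounded =
  filter P? (box a b c) ,
  λ x → mk⇔ (proj₂ ∘ ∈-filter⁻ P? {xs = box a b c}) (λ Px → ∈-filter⁺ P? (∈-box (bounded Px)) Px)
  where
  ∈-box : ∀ {u v w} → ∣ u ∣ ℕ.≤ a × ∣ v ∣ ℕ.≤ b × ∣ w ∣ ℕ.≤ c → (u , v , w) ∈ box a b c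
  ∈-box (u≤a , v≤b , w≤c) = ∈-cartesianProduct⁺ (∣i∣≤k⇒i∈interval u≤a)
    (∈-cartesianProduct⁺ (∣i∣≤k⇒i∈interval v≤b) (∣i∣≤k⇒i∈interval w≤c))

representations-listable : ∀ n r m → 0ℤ < - disc n r m → ∀ A →
  Σ[ xs ∈ List ℤ³ ] (∀ x → x ∈ xs ⇔ (InL n r m x × Q x ≡ A))
representations-listable n r m 0<-disc A = bounded⇒listable represents?
  (∣ + 4 * m * (n * A) ∣) (∣ + 4 * n * (n * A) ∣) (∣ + 4 * m * (m * A) ∣) bounds
  where
  represents? : Decidable (λ x → InL n r m x × Q x ≡ A)
  represents? (u , v , w) = (r * u + m * v + n * w ≟ 0ℤ) ×-dec (Q (u , v , w) ≟ A)
  0<-disc′ : 0ℤ < - disc m r n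
  0<-disc′ = subst (λ d → 0ℤ < - d) (disc-swap n r m) 0<-disc
  bounds : ∀ {u v w} → InL n r m (u , v , w) × Q (u , v , w) ≡ A →
    ∣ u ∣ ℕ.≤ ∣ + 4 * m * (n * A) ∣ × ∣ v ∣ ℕ.≤ ∣ + 4 * n * (n * A) ∣ × ∣ w ∣ ℕ.≤ ∣ + 4 * m * (m * A) ∣
  bounds {u} {v} {w} (x∈L , Qx≡A) =
      subst (λ z → ∣ u ∣ ℕ.≤ ∣ + 4 * m * z ∣) (trans (form-swap m r n v u) nA) (∣y∣≤∣4a*form∣ m r n v u 0<-disc′)
    , subst (λ z → ∣ v ∣ ℕ.≤ ∣ + 4 * n * z ∣) nA (∣y∣≤∣4a*form∣ n r m u v 0<-disc)
    , subst (λ z → ∣ w ∣ ℕ.≤ ∣ + 4 * m * z ∣) mA (∣y∣≤∣4a*form∣ m r n u w 0<-disc′)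
    where
    nA : form n r m u v ≡ n * A
    nA = trans (sym (n*Q≡form n r m u v w x∈L)) (cong (n *_) Qx≡A)
    mA : form m r n u w ≡ m * A
    mA = trans (sym (m*Q≡form n r m u v w x∈L)) (cong (m *_) Qx≡A)

lemma3p14 : (M n r m : ℤ) → 0ℤ < M → Coprime3 n r m → PosDefT M n r m →
    ((∀ x → InL n r m x → ¬ (x ≡ zero³) → 0ℤ < Q x)
      × Σ[ e₁ ∈ ℤ³ ] Σ[ e₂ ∈ ℤ³ ] (IsBasis n r m e₁ e₂ × discBasis e₁ e₂ ≡ disc n r m))
    × (∀ (A : ℤ) → 0ℤ < A →
        Σ[ xs ∈ List ℤ³ ] (∀ x → (x ∈ xs) ⇔ (InL n r m x × Q x ≡ A)))
lemma3p14 M n r m 0<M coprime posDefT =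
  (Q-positive posDef , lattice-basis n r m coprime n≢0) ,
  λ A _ → representations-listable n r m (posDef⇒0<-disc posDef) A
  where
  posDef : PositiveDefinite n r m
  posDef = PosDefT⇒PositiveDefinite 0<M posDefT
  n≢0 : n ≢ 0ℤ
  n≢0 = ≢-sym (<⇒≢ (posDef⇒0<a posDef))
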